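{- For any permutation $\sigma\in\mathrm{Sym}(n)$, the cyclic group $G=\langle\sigma\rangle\leq\mathrm{Sym}(n)$, with its natural action on $\{1,\dots,n\}$, has the strict EKR property.
   Context: Two permutations $\pi,\tau\in G$ intersect if $\pi\tau^{ -1}$ has a fixed point in $\{1,\dots,n\}$; a subset of $G$ is intersecting if every pair of its elements intersect. $G$ has the EKR property if every intersecting subset of $G$ has size at most the size of the largest point-stabilizer $G_x$. $G$ has the strict EKR property if it has the EKR property and moreover the only intersecting subsets of $G$ of maximum size are the cosets of the (largest) point-stabilizers. -}

module Defs where

open import Data.Nat using (ℕ; zero; suc; _≤_)
open import Data.Fin using (Fin)
open import Data.Fin.Permutation using (Permutation′; _⟨$⟩ʳ_; _⟨$⟩ˡ_; _≈_; id; _∘ₚ_)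
open import Data.List using (List; length)
open import Data.List.Relation.Unary.All using (All)
open import Data.List.Relation.Unary.Any using (Any)
open import Data.List.Relation.Unary.AllPairs using (AllPairs)
open import Data.Product using (Σ; ∃; _×_)
open import Relation.Binary.PropositionalEquality using (_≡_)
open import Relation.Nullary using (¬_)

-- Elements of Sym(n): permutations of Fin n (= {1,…,n}); equality of
-- permutations is the library's pointwise equality _≈_.
Perm : ℕ → Set
Perm n = Permutation′ n

-- Composition in function notation: (π · τ)(i) = π (τ i).
_·_ : ∀ {n} → Perm n → Perm n → Perm n
π · τ = τ ∘ₚ π

_^_ : ∀ {n} → Perm n → ℕ → Perm n
σ ^ zero  = id
σ ^ suc k = σ · (σ ^ k)

-- A subgroup of Sym(n) is given by its membership predicate.
-- The cyclic group ⟨σ⟩ (finite, so nonnegative powers suffice).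
⟨_⟩ : ∀ {n} → Perm n → Perm n → Set
⟨ σ ⟩ π = ∃ λ k → π ≈ (σ ^ k)

Intersect : ∀ {n} → Perm n → Perm n → Set
Intersect {n} π τ = ∃ λ (i : Fin n) → π ⟨$⟩ʳ (τ ⟨$⟩ˡ i) ≡ i

-- Finite subsets are represented by duplicate-free lists (up to _≈_).
Distinct : ∀ {n} → List (Perm n) → Set
Distinct = AllPairs (λ π τ → ¬ (π ≈ τ))

Enumerates : ∀ {n} → (Perm n → Set) → List (Perm n) → Set
Enumerates P L = Distinct L × All P L × (∀ π → P π → Any (π ≈_) L)

HasSize : ∀ {n} → (Perm n → Set) → ℕ → Set
HasSize P m = Σ _ λ L → Enumerates P L × length L ≡ m

IsSubsetOf : ∀ {n} → (Perm n → Set) → List (Perm n) → Set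
IsSubsetOf G F = Distinct F × All G F

Intersecting : ∀ {n} → List (Perm n) → Set
Intersecting = AllPairs Intersect

Stab : ∀ {n} → (Perm n → Set) → Fin n → Perm n → Set
Stab G x π = G π × π ⟨$⟩ʳ x ≡ x

Coset : ∀ {n} → (Perm n → Set) → Perm n → Fin n → Perm n → Set
Coset G g x π = ∃ λ h → Stab G x h × π ≈ (g · h)

MaxStabSize : ∀ {n} → (Perm n → Set) → ℕ → Set
MaxStabSize {n} G m =
  (∃ λ (x : Fin n) → HasSize (Stab G x) m) ×
  (∀ (x : Fin n) m′ → HasSize (Stab G x) m′ → m′ ≤ m)

EKR : ∀ {n} → (Perm n → Set) → Set
EKR {n} G = ∀ m → MaxStabSize G m →
  ∀ (F : List (Perm n)) → IsSubsetOf G F → Intersecting F → length F ≤ m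

StrictEKR : ∀ {n} → (Perm n → Set) → Set
StrictEKR {n} G = EKR G ×
  (∀ m → MaxStabSize G m →
   ∀ (F : List (Perm n)) → IsSubsetOf G F → Intersecting F → length F ≡ m →
   ∃ λ g → G g × ∃ λ (x : Fin n) → HasSize (Stab G x) m × Enumerates (Coset G g x) F)

-- Let ℓ be the length of a shortest orbit of σ, y a point on it, and d ℓ the order of
-- σ, so that G_y = ⟨σ^ℓ⟩ has d elements. Fix any offset s and write each element of G
-- as σ^(s + q ℓ + r) with q < d and r < ℓ. No σ^k with 0 < k < ℓ has a fixed point, so
-- two elements agreeing at some point never share the block q: a set of pairwise
-- agreeing elements (an intersecting set, or a stabilizer) has at most d elements, and
-- one with exactly d elements meets every block, for every offset. For σ^k ∈ F, the
-- block just after σ^k then forces σ^(k + ℓ) ∈ F, hence σ^k G_y ⊆ F; conversely each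
-- element of F shares its block with some σ^(k + q ℓ) ∈ F and so equals it.

module Submission where

open import Defs
open import Data.Empty using (⊥-elim)
open import Data.Fin using (Fin; toℕ; fromℕ<; _≟_; punchOut) renaming (zero to fzero; suc to fsuc)
open import Data.Fin.Properties using (pigeonhole; injective⇒≤; punchOut-injective; any?; all?; toℕ-fromℕ<; toℕ≤pred[n]; toℕ<n)
open import Data.Fin.Permutation using (_⟨$⟩ʳ_; _⟨$⟩ˡ_; inverseˡ; inverseʳ; _≈_)
open import Data.List using (List; _∷_; length; lookup; applyUpTo)
open import Data.List.Membership.Propositional using (_∈_; find; lose)
open import Data.List.Membership.Propositional.Properties using (∈-lookup)
open import Data.List.Properties using (length-applyUpTo)
open import Data.List.Relation.Unary.All as All using (All; _∷_)
import Data.List.Relation.Unary.All.Properties as All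
open import Data.List.Relation.Unary.Any as Any using (Any; here; there)
import Data.List.Relation.Unary.Any.Properties as Any
open import Data.List.Relation.Unary.AllPairs using (_∷_)
import Data.List.Relation.Unary.AllPairs.Properties as AllPairs
open import Data.Nat using (ℕ; zero; suc; _+_; _*_; _∸_; _≤_; _<_; _!; z<s; NonZero; >-nonZero; >-nonZero⁻¹)
open import Data.Nat.Properties hiding (_≟_)
open import Data.Nat.DivMod using (_/_; _%_; m≡m%n+[m/n]*n; m%n<n; m<n*o⇒m/o<n)
open import Data.Nat.Divisibility using (divides; m≤n⇒m!∣n!; ∣-trans)
open import Data.Nat.Induction using (<-rec)
open import Data.Product using (∃; _×_; _,_; proj₁; proj₂)
open import Data.Sum using ([_,_]′)
open import Function using (_∘_)
open import Function.Definitions using (Injective)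
open import Relation.Nullary using (¬_; yes; no; contradiction)
open import Relation.Nullary.Decidable using (_×-dec_)
open import Relation.Unary using (Decidable)
open import Relation.Binary.PropositionalEquality
open ≡-Reasoning

Least : (ℕ → Set) → ℕ → Set
Least P m = P m × (∀ {j} → j < m → ¬ P j)

least : ∀ {P : ℕ → Set} → Decidable P → ∀ {k} → P k → ∃ (Least P)
least {P} P? {k} = <-rec (λ k → P k → ∃ (Least P)) search k
  where
  search : ∀ k → (∀ {j} → j < k → P j → ∃ (Least P)) → P k → ∃ (Least P)
  search k below pk with anyUpTo? P? k
  ... | yes (j , j<k , pj) = below j<k pj
  ... | no none = k , pk , λ j<k pj → none (_ , j<k , pj)

Positive : (ℕ → Set) → ℕ → Set
Positive P k = 0 < k × P k

least-positive : ∀ {P : ℕ → Set} → Decidable P → ∀ {k} → 0 < k → P k →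
                 ∃ λ m → 0 < m × P m × (∀ {j} → 0 < j → P j → m ≤ j)
least-positive {P} P? k>0 pk with least {Positive P} (λ k → (0 <? k) ×-dec P? k) (k>0 , pk)
... | m , (m>0 , pm) , minimal = m , m>0 , pm , λ j>0 pj → ≮⇒≥ λ j<m → minimal j<m (j>0 , pj)

Agree : ∀ {n} → Perm n → Perm n → Set
Agree {n} π τ = ∃ λ (z : Fin n) → π ⟨$⟩ʳ z ≡ τ ⟨$⟩ʳ z

Agree-sym : ∀ {n} {π τ : Perm n} → Agree π τ → Agree τ π
Agree-sym (z , e) = z , sym e

Intersect⇒Agree : ∀ {n} {π τ : Perm n} → Intersect π τ → Agree π τ
Intersect⇒Agree {τ = τ} (i , e) = τ ⟨$⟩ˡ i , trans e (sym (inverseʳ τ))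

Agreeing : ∀ {n} → List (Perm n) → Set
Agreeing F = ∀ {π τ} → π ∈ F → τ ∈ F → Agree π τ

intersecting⇒agreeing : ∀ {n} {F : List (Perm (suc n))} → Intersecting F → Agreeing F
intersecting⇒agreeing (_ ∷ _)  (here refl) (here refl) = fzero , refl
intersecting⇒agreeing (px ∷ _) {π} {τ} (here refl) (there τ∈) =
  Intersect⇒Agree {π = π} {τ} (All.lookup px τ∈)
intersecting⇒agreeing (px ∷ _) {π} {τ} (there π∈) (here refl) =
  Agree-sym {π = τ} {π} (Intersect⇒Agree {π = τ} {π} (All.lookup px π∈))
intersecting⇒agreeing (_ ∷ ps) (there π∈) (there τ∈) = intersecting⇒agreeing ps π∈ τ∈

agree-up-to-≈ : ∀ {n} {F : List (Perm n)} → Agreeing F →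
                ∀ {π τ} → Any (π ≈_) F → Any (τ ≈_) F → Agree π τ
agree-up-to-≈ agreeing π∈ τ∈ with find π∈ | find τ∈
... | _ , π′∈ , π≈π′ | _ , τ′∈ , τ≈τ′ =
  let z , e = agreeing π′∈ τ′∈ in z , trans (π≈π′ z) (trans e (sym (τ≈τ′ z)))

∈-resp-≈ : ∀ {n} {F : List (Perm n)} {π π′} → π ≈ π′ → Any (π′ ≈_) F → Any (π ≈_) F
∈-resp-≈ π≈π′ = Any.map λ π′≈τ z → trans (π≈π′ z) (π′≈τ z)

distinct⇒lookup-injective : ∀ {n} {F : List (Perm n)} → Distinct F →
                            ∀ {i j} → lookup F i ≈ lookup F j → i ≡ j
distinct⇒lookup-injective (_ ∷ _) {fzero} {fzero} _ = refl
distinct⇒lookup-injective (px ∷ _) {fzero} {fsuc j} e = ⊥-elim (All.lookup px (∈-lookup j) e)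
distinct⇒lookup-injective (px ∷ _) {fsuc i} {fzero} e = ⊥-elim (All.lookup px (∈-lookup i) λ z → sym (e z))
distinct⇒lookup-injective (_ ∷ ps) {fsuc i} {fsuc j} e = cong fsuc (distinct⇒lookup-injective ps e)

injective⇒hits : ∀ {m k} (f : Fin m → Fin k) → Injective _≡_ _≡_ f → m ≡ k → ∀ y → ∃ λ x → f x ≡ y
injective⇒hits {k = suc k} f f-inj refl y with any? (λ x → f x ≟ y)
... | yes hit = hit
... | no miss = contradiction (injective⇒≤ punched-injective) (n≮n k)
  where
  f≢y : ∀ x → y ≢ f x
  f≢y x e = miss (x , sym e)
  punched-injective : Injective _≡_ _≡_ (λ x → punchOut (f≢y x))
  punched-injective e = f-inj (punchOut-injective (f≢y _) (f≢y _) e)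

module Powers {n : ℕ} (σ : Perm (suc n)) where

  infixr 5 _↷_
  _↷_ : ℕ → Fin (suc n) → Fin (suc n)
  k ↷ i = (σ ^ k) ⟨$⟩ʳ i

  ↷-+ : ∀ a b i → (a + b) ↷ i ≡ a ↷ b ↷ i
  ↷-+ zero    b i = refl
  ↷-+ (suc a) b i = cong (σ ⟨$⟩ʳ_) (↷-+ a b i)

  ↷-injective : ∀ k {i j} → k ↷ i ≡ k ↷ j → i ≡ j
  ↷-injective k {i} {j} e = begin
    i                           ≡⟨ inverseˡ (σ ^ k) ⟨
    (σ ^ k) ⟨$⟩ˡ (k ↷ i)        ≡⟨ cong ((σ ^ k) ⟨$⟩ˡ_) e ⟩
    (σ ^ k) ⟨$⟩ˡ (k ↷ j)        ≡⟨ inverseˡ (σ ^ k) ⟩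
    j                           ∎

  ↷-* : ∀ {p i} → p ↷ i ≡ i → ∀ c → (c * p) ↷ i ≡ i
  ↷-* p↷i zero    = refl
  ↷-* {p} {i} p↷i (suc c) = begin
    (p + c * p) ↷ i  ≡⟨ ↷-+ p (c * p) i ⟩
    p ↷ (c * p) ↷ i  ≡⟨ cong (p ↷_) (↷-* p↷i c) ⟩
    p ↷ i            ≡⟨ p↷i ⟩
    i                ∎

  ↷-∸ : ∀ {a b i} → a ≤ b → a ↷ i ≡ b ↷ i → (b ∸ a) ↷ i ≡ i
  ↷-∸ {a} {b} {i} a≤b e = ↷-injective a (begin
    a ↷ (b ∸ a) ↷ i  ≡⟨ ↷-+ a (b ∸ a) i ⟨
    (a + (b ∸ a)) ↷ i ≡⟨ cong (_↷ i) (m+[n∸m]≡n a≤b) ⟩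
    b ↷ i             ≡⟨ e ⟨
    a ↷ i             ∎)

  ^-+-homo : ∀ a b → (σ ^ a) · (σ ^ b) ≈ σ ^ (a + b)
  ^-+-homo a b i = sym (↷-+ a b i)

  period : ∀ i → ∃ λ p → 0 < p × p ≤ suc n × p ↷ i ≡ i
  period i with pigeonhole (n<1+n (suc n)) (λ t → toℕ t ↷ i)
  ... | a , b , a<b , e =
    toℕ b ∸ toℕ a , m<n⇒0<n∸m a<b , ≤-trans (m∸n≤m (toℕ b) (toℕ a)) (toℕ≤pred[n] b) ,
    ↷-∸ (<⇒≤ a<b) e

  -- Every point period is at most n + 1, hence divides (n + 1)!.
  ↷-factorial : ∀ i → (suc n) ! ↷ i ≡ i
  ↷-factorial i with period i
  ... | suc p , _ , p≤ , p↷i with ∣-trans (divides (p !) (*-comm (suc p) (p !))) (m≤n⇒m!∣n! p≤)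
  ... | divides c eq = trans (cong (_↷ i) eq) (↷-* p↷i c)

  ↷-% : ∀ {N} .{{_ : NonZero N}} → (∀ i → N ↷ i ≡ i) → ∀ k i → (k % N) ↷ i ≡ k ↷ i
  ↷-% {N} N↷ k i = begin
    (k % N) ↷ i                   ≡⟨ cong ((k % N) ↷_) (↷-* (N↷ i) (k / N)) ⟨
    (k % N) ↷ (k / N * N) ↷ i     ≡⟨ ↷-+ (k % N) (k / N * N) i ⟨
    (k % N + k / N * N) ↷ i       ≡⟨ cong (_↷ i) (m≡m%n+[m/n]*n k N) ⟨
    k ↷ i                         ∎

  shift-exponent : ∀ {N} .{{_ : NonZero N}} → (∀ i → N ↷ i ≡ i) →
          ∀ s k → ∃ λ u → u < N × ∀ i → (s + u) ↷ i ≡ k ↷ i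
  shift-exponent {N} N↷ s k = u % N , m%n<n u N , λ i → begin
    (s + u % N) ↷ i    ≡⟨ ↷-+ s (u % N) i ⟩
    s ↷ (u % N) ↷ i    ≡⟨ cong (s ↷_) (↷-% N↷ u i) ⟩
    s ↷ u ↷ i          ≡⟨ ↷-+ s u i ⟨
    (s + u) ↷ i        ≡⟨ cong (_↷ i) (m+[n∸m]≡n s≤k+sN) ⟩
    (k + s * N) ↷ i    ≡⟨ ↷-+ k (s * N) i ⟩
    k ↷ (s * N) ↷ i    ≡⟨ cong (k ↷_) (↷-* (N↷ i) s) ⟩
    k ↷ i              ∎
    where
    u = k + s * N ∸ s
    s≤k+sN : s ≤ k + s * N
    s≤k+sN = ≤-trans (m≤m*n s N) (m≤n+m (s * N) k)

  record ShortestOrbit : Set where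
    field
      ℓ d : ℕ
      ⦃ ℓ≢0 ⦄ : NonZero ℓ
      ⦃ d≢0 ⦄ : NonZero d
      y : Fin (suc n)
      ℓ↷y : ℓ ↷ y ≡ y
      ℓ-minimal : ∀ {k i} → 0 < k → k ↷ i ≡ i → ℓ ≤ k
      dℓ↷ : ∀ i → (d * ℓ) ↷ i ≡ i
      d-minimal : ∀ {j} → 0 < j → (∀ i → (j * ℓ) ↷ i ≡ i) → d ≤ j

  shortestOrbit : ShortestOrbit
  shortestOrbit with period fzero
  ... | _ , p>0 , _ , p↷0 with least-positive (λ k → any? (λ i → k ↷ i ≟ i)) p>0 (fzero , p↷0)
  ... | ℓ , ℓ>0 , (y , ℓ↷y) , ℓ-minimal
    with least-positive (λ j → all? (λ i → (j * ℓ) ↷ i ≟ i)) (1≤n! (suc n)) [n+1]!ℓ↷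
    where
    [n+1]!ℓ↷ : ∀ i → ((suc n) ! * ℓ) ↷ i ≡ i
    [n+1]!ℓ↷ i = trans (cong (_↷ i) (*-comm ((suc n) !) ℓ)) (↷-* (↷-factorial i) ℓ)
  ... | d , d>0 , dℓ↷ , d-minimal = record
    { ℓ = ℓ ; d = d ; ℓ≢0 = >-nonZero ℓ>0 ; d≢0 = >-nonZero d>0 ; y = y ; ℓ↷y = ℓ↷y
    ; ℓ-minimal = λ k>0 k↷i → ℓ-minimal k>0 (_ , k↷i)
    ; dℓ↷ = dℓ↷ ; d-minimal = d-minimal }

  module Blocks (D : ShortestOrbit) where
    open ShortestOrbit D

    fixed-below-ℓ : ∀ {r i} → r < ℓ → r ↷ i ≡ i → r ≡ 0
    fixed-below-ℓ {zero}  _   _   = refl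
    fixed-below-ℓ {suc r} r<ℓ r↷i = contradiction (ℓ-minimal z<s r↷i) (<⇒≱ r<ℓ)

    ↷-injective-below-ℓ : ∀ {r r′ i} → r < ℓ → r′ < ℓ → r ↷ i ≡ r′ ↷ i → r ≡ r′
    ↷-injective-below-ℓ {r} {r′} r<ℓ r′<ℓ e =
      [ (λ r≤r′ → ordered r≤r′ r′<ℓ e) , (λ r′≤r → sym (ordered r′≤r r<ℓ (sym e))) ]′ (≤-total r r′)
      where
      ordered : ∀ {a b i} → a ≤ b → b < ℓ → a ↷ i ≡ b ↷ i → a ≡ b
      ordered {a} {b} a≤b b<ℓ e =
        ≤-antisym a≤b (m∸n≡0⇒m≤n (fixed-below-ℓ (≤-<-trans (m∸n≤m b a) b<ℓ) (↷-∸ a≤b e)))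

    private instance
      dℓ≢0 : NonZero (d * ℓ)
      dℓ≢0 = m*n≢0 d ℓ

    record Position (s : ℕ) (π : Perm (suc n)) : Set where
      constructor position
      field
        block : Fin d
        offset : ℕ
        offset<ℓ : offset < ℓ
        ≈-power : π ≈ σ ^ (s + toℕ block * ℓ + offset)

    locate : ∀ s {π} → ⟨ σ ⟩ π → Position s π
    locate s {π} (k , π≈σ^k) with shift-exponent dℓ↷ s k
    ... | u , u<dℓ , s+u↷ = position (fromℕ< q<d) (u % ℓ) (m%n<n u ℓ) λ i → begin
      π ⟨$⟩ʳ i                               ≡⟨ π≈σ^k i ⟩
      k ↷ i                                  ≡⟨ s+u↷ i ⟨
      (s + u) ↷ i                            ≡⟨ cong (_↷ i) s+u≡ ⟩
      (s + toℕ (fromℕ< q<d) * ℓ + u % ℓ) ↷ i ∎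
      where
      q<d : u / ℓ < d
      q<d = m<n*o⇒m/o<n u<dℓ
      s+u≡ : s + u ≡ s + toℕ (fromℕ< q<d) * ℓ + u % ℓ
      s+u≡ = begin
        s + u                                ≡⟨ cong (s +_) (m≡m%n+[m/n]*n u ℓ) ⟩
        s + (u % ℓ + u / ℓ * ℓ)              ≡⟨ cong (s +_) (+-comm (u % ℓ) (u / ℓ * ℓ)) ⟩
        s + (u / ℓ * ℓ + u % ℓ)              ≡⟨ +-assoc s (u / ℓ * ℓ) (u % ℓ) ⟨
        s + u / ℓ * ℓ + u % ℓ                ≡⟨ cong (λ q → s + q * ℓ + u % ℓ) (toℕ-fromℕ< q<d) ⟨
        s + toℕ (fromℕ< q<d) * ℓ + u % ℓ     ∎

    same-offset : ∀ {a r r′ π τ} → r < ℓ → r′ < ℓ → π ≈ σ ^ (a + r) → τ ≈ σ ^ (a + r′) →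
                  Agree π τ → r ≡ r′
    same-offset {a} {r} {r′} {π} {τ} r<ℓ r′<ℓ π≈ τ≈ (z , πz≡τz) =
      ↷-injective-below-ℓ r<ℓ r′<ℓ (↷-injective a (begin
        a ↷ r ↷ z     ≡⟨ ↷-+ a r z ⟨
        (a + r) ↷ z   ≡⟨ π≈ z ⟨
        π ⟨$⟩ʳ z      ≡⟨ πz≡τz ⟩
        τ ⟨$⟩ʳ z      ≡⟨ τ≈ z ⟩
        (a + r′) ↷ z  ≡⟨ ↷-+ a r′ z ⟩
        a ↷ r′ ↷ z    ∎))

    same-block⇒≈ : ∀ {s π τ} (p : Position s π) (p′ : Position s τ) →
                   Position.block p ≡ Position.block p′ → Agree π τ → π ≈ τ
    same-block⇒≈ {s} {π} {τ} (position q r r<ℓ π≈) (position .q r′ r′<ℓ τ≈) refl agree z = begin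
      π ⟨$⟩ʳ z                   ≡⟨ π≈ z ⟩
      (s + toℕ q * ℓ + r) ↷ z    ≡⟨ cong (λ r → (s + toℕ q * ℓ + r) ↷ z) r≡r′ ⟩
      (s + toℕ q * ℓ + r′) ↷ z   ≡⟨ τ≈ z ⟨
      τ ⟨$⟩ʳ z                   ∎
      where
      r≡r′ = same-offset {a = s + toℕ q * ℓ} {π = π} {τ} r<ℓ r′<ℓ π≈ τ≈ agree

    fixes-y⇒multiple-of-ℓ : ∀ {π} → Stab ⟨ σ ⟩ y π → ∃ λ q → q < d × π ≈ σ ^ (q * ℓ)
    fixes-y⇒multiple-of-ℓ {π} (π∈G , πy≡y) with locate 0 {π} π∈G
    ... | position q r r<ℓ π≈ = toℕ q , toℕ<n q , λ i → begin
      π ⟨$⟩ʳ i              ≡⟨ π≈ i ⟩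
      (qℓ + r) ↷ i          ≡⟨ cong (λ t → (qℓ + t) ↷ i) r≡0 ⟩
      (qℓ + 0) ↷ i          ≡⟨ cong (_↷ i) (+-identityʳ qℓ) ⟩
      qℓ ↷ i                ∎
      where
      qℓ = toℕ q * ℓ
      r≡0 : r ≡ 0
      r≡0 = fixed-below-ℓ r<ℓ (↷-injective qℓ (begin
        qℓ ↷ r ↷ y          ≡⟨ ↷-+ qℓ r y ⟨
        (qℓ + r) ↷ y        ≡⟨ π≈ y ⟨
        π ⟨$⟩ʳ y            ≡⟨ πy≡y ⟩
        y                   ≡⟨ ↷-* ℓ↷y (toℕ q) ⟨
        qℓ ↷ y              ∎))

    multiple-of-ℓ-fixes-y : ∀ j → Stab ⟨ σ ⟩ y (σ ^ (j * ℓ))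
    multiple-of-ℓ-fixes-y j = (j * ℓ , λ _ → refl) , ↷-* ℓ↷y j

    multiples-of-ℓ : List (Perm (suc n))
    multiples-of-ℓ = applyUpTo (λ j → σ ^ (j * ℓ)) d

    multiples-of-ℓ-distinct : Distinct multiples-of-ℓ
    multiples-of-ℓ-distinct = AllPairs.applyUpTo⁺₁ (λ j → σ ^ (j * ℓ)) d distinct
      where
      distinct : ∀ {i j} → i < j → j < d → ¬ (σ ^ (i * ℓ) ≈ σ ^ (j * ℓ))
      distinct {i} {j} i<j j<d iℓ≈jℓ = <⇒≱ j<d (≤-trans (d-minimal (m<n⇒0<n∸m i<j) [j∸i]ℓ↷) (m∸n≤m j i))
        where
        [j∸i]ℓ↷ : ∀ z → ((j ∸ i) * ℓ) ↷ z ≡ z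
        [j∸i]ℓ↷ z = trans (cong (_↷ z) (*-distribʳ-∸ ℓ j i)) (↷-∸ (*-monoˡ-≤ ℓ (<⇒≤ i<j)) (iℓ≈jℓ z))

    stabilizer-size : HasSize (Stab ⟨ σ ⟩ y) d
    stabilizer-size =
      multiples-of-ℓ ,
      (multiples-of-ℓ-distinct , All.applyUpTo⁺₂ (λ j → σ ^ (j * ℓ)) d multiple-of-ℓ-fixes-y , complete) ,
      length-applyUpTo (λ j → σ ^ (j * ℓ)) d
      where
      complete : ∀ π → Stab ⟨ σ ⟩ y π → Any (π ≈_) multiples-of-ℓ
      complete π π∈Gy with fixes-y⇒multiple-of-ℓ {π} π∈Gy
      ... | q , q<d , π≈ = Any.applyUpTo⁺ (λ j → σ ^ (j * ℓ)) π≈ q<d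

    module _ {F : List (Perm (suc n))}
             (F-distinct : Distinct F) (F⊆G : All ⟨ σ ⟩ F) (F-agreeing : Agreeing F) where

      locate-lookup : ∀ s i → Position s (lookup F i)
      locate-lookup s i = locate s (All.lookup F⊆G (∈-lookup i))

      block-injective : ∀ s → Injective _≡_ _≡_ (Position.block ∘ locate-lookup s)
      block-injective s {i} {j} same = distinct⇒lookup-injective F-distinct
        (same-block⇒≈ (locate-lookup s i) (locate-lookup s j) same (F-agreeing (∈-lookup i) (∈-lookup j)))

      length≤d : length F ≤ d
      length≤d = injective⇒≤ (block-injective 0)

      module _ (|F|≡d : length F ≡ d) where

        meets-every-window : ∀ s → ∃ λ r → r < ℓ × Any (σ ^ (s + r) ≈_) F
        meets-every-window s with injective⇒hits _ (block-injective s) |F|≡d (fromℕ< (>-nonZero⁻¹ d))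
        ... | i , hit =
          offset , offset<ℓ , lose (∈-lookup i) λ z → sym (trans (≈-power z) (cong (_↷ z) exp≡))
          where
          open Position (locate-lookup s i)
          block≡0 : toℕ block ≡ 0
          block≡0 = trans (cong toℕ hit) (toℕ-fromℕ< _)
          exp≡ : s + toℕ block * ℓ + offset ≡ s + offset
          exp≡ = begin
            s + toℕ block * ℓ + offset  ≡⟨ cong (λ t → s + t * ℓ + offset) block≡0 ⟩
            s + 0 + offset              ≡⟨ cong (_+ offset) (+-identityʳ s) ⟩
            s + offset                  ∎

        -- The window just after σ^m meets F in some σ^(m + 1 + r) with r < ℓ; as it
        -- agrees with σ^m, the power σ^(1 + r) has a fixed point, forcing 1 + r = ℓ.
        +ℓ-closed : ∀ {m} → Any (σ ^ m ≈_) F → Any (σ ^ (m + ℓ) ≈_) F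
        +ℓ-closed {m} m∈F = subst (λ e → Any (σ ^ e ≈_) F) 1+m+r≡m+ℓ next∈F
          where
          window : ∃ λ r → r < ℓ × Any (σ ^ (suc m + r) ≈_) F
          window = meets-every-window (suc m)
          r = proj₁ window
          r<ℓ = proj₁ (proj₂ window)
          next∈F = proj₂ (proj₂ window)
          agree : Agree (σ ^ m) (σ ^ (suc m + r))
          agree = agree-up-to-≈ F-agreeing {σ ^ m} {σ ^ (suc m + r)} m∈F next∈F
          z : Fin (suc n)
          z = proj₁ agree
          1+r↷z : suc r ↷ z ≡ z
          1+r↷z = ↷-injective m (begin
            m ↷ suc r ↷ z     ≡⟨ ↷-+ m (suc r) z ⟨
            (m + suc r) ↷ z   ≡⟨ cong (_↷ z) (+-suc m r) ⟩
            suc (m + r) ↷ z   ≡⟨ proj₂ agree ⟨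
            m ↷ z             ∎)
          1+m+r≡m+ℓ : suc m + r ≡ m + ℓ
          1+m+r≡m+ℓ = trans (sym (+-suc m r)) (cong (m +_) (≤-antisym r<ℓ (ℓ-minimal z<s 1+r↷z)))

        multiples-closed : ∀ {m} → Any (σ ^ m ≈_) F → ∀ j → Any (σ ^ (m + j * ℓ) ≈_) F
        multiples-closed {m} m∈F zero = subst (λ e → Any (σ ^ e ≈_) F) (sym (+-identityʳ m)) m∈F
        multiples-closed {m} m∈F (suc j) =
          subst (λ e → Any (σ ^ e ≈_) F) m+jℓ+ℓ≡ (+ℓ-closed {m + j * ℓ} (multiples-closed {m} m∈F j))
          where
          m+jℓ+ℓ≡ : m + j * ℓ + ℓ ≡ m + suc j * ℓ
          m+jℓ+ℓ≡ = trans (+-assoc m (j * ℓ) ℓ) (cong (m +_) (+-comm (j * ℓ) ℓ))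

        is-coset-of-stabilizer : ∃ λ g → ⟨ σ ⟩ g × Enumerates (Coset ⟨ σ ⟩ g y) F
        is-coset-of-stabilizer = σ ^ k , (k , λ _ → refl) , F-distinct , All.tabulate in-coset , complete
          where
          k : ℕ
          k = proj₁ (meets-every-window 0)
          k∈F : Any (σ ^ k ≈_) F
          k∈F = proj₂ (proj₂ (meets-every-window 0))
          in-coset : ∀ {π} → π ∈ F → Coset ⟨ σ ⟩ (σ ^ k) y π
          in-coset {π} π∈F = σ ^ qℓ , multiple-of-ℓ-fixes-y (toℕ block) , λ i → begin
            π ⟨$⟩ʳ i                    ≡⟨ ≈-power i ⟩
            (k + qℓ + offset) ↷ i       ≡⟨ cong (λ t → (k + qℓ + t) ↷ i) (sym 0≡offset) ⟩
            (k + qℓ + 0) ↷ i            ≡⟨ cong (_↷ i) (+-identityʳ (k + qℓ)) ⟩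
            (k + qℓ) ↷ i                ≡⟨ ^-+-homo k qℓ i ⟨
            ((σ ^ k) · (σ ^ qℓ)) ⟨$⟩ʳ i ∎
            where
            open Position (locate k {π} (All.lookup F⊆G π∈F))
            qℓ = toℕ block * ℓ
            block-start∈F : Any (σ ^ (k + qℓ + 0) ≈_) F
            block-start∈F = subst (λ e → Any (σ ^ e ≈_) F) (sym (+-identityʳ (k + qℓ)))
                                  (multiples-closed {k} k∈F (toℕ block))
            0≡offset : 0 ≡ offset
            0≡offset = same-offset {a = k + qℓ} {π = σ ^ (k + qℓ + 0)} {π} (>-nonZero⁻¹ ℓ) offset<ℓ
              (λ _ → refl) ≈-power
              (agree-up-to-≈ F-agreeing {σ ^ (k + qℓ + 0)} {π} block-start∈F (lose π∈F λ _ → refl))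
          complete : ∀ π → Coset ⟨ σ ⟩ (σ ^ k) y π → Any (π ≈_) F
          complete π (h , h∈Gy , π≈σ^k·h) =
            ∈-resp-≈ {π = π} {σ ^ (k + j * ℓ)} π≈ (multiples-closed {k} k∈F j)
            where
            j : ℕ
            j = proj₁ (fixes-y⇒multiple-of-ℓ {h} h∈Gy)
            h≈ : h ≈ σ ^ (j * ℓ)
            h≈ = proj₂ (proj₂ (fixes-y⇒multiple-of-ℓ {h} h∈Gy))
            π≈ : π ≈ σ ^ (k + j * ℓ)
            π≈ z = trans (π≈σ^k·h z) (trans (cong (k ↷_) (h≈ z)) (sym (↷-+ k (j * ℓ) z)))

    largest-stabilizer-size : ∀ {m} → MaxStabSize ⟨ σ ⟩ m → m ≡ d
    largest-stabilizer-size ((x , L , (L-distinct , L⊆Gx , _) , refl) , maximal) =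
      ≤-antisym (length≤d L-distinct (All.map proj₁ L⊆Gx) agree-at-x) (maximal y d stabilizer-size)
      where
      agree-at-x : Agreeing L
      agree-at-x π∈L τ∈L = x , trans (proj₂ (All.lookup L⊆Gx π∈L)) (sym (proj₂ (All.lookup L⊆Gx τ∈L)))

    intersecting-bound : EKR ⟨ σ ⟩
    intersecting-bound m max F (F-distinct , F⊆G) F-intersecting =
      subst (length F ≤_) (sym (largest-stabilizer-size max))
            (length≤d F-distinct F⊆G (intersecting⇒agreeing F-intersecting))

    maximum-intersecting-is-coset :
      ∀ m → MaxStabSize ⟨ σ ⟩ m →
      ∀ F → IsSubsetOf ⟨ σ ⟩ F → Intersecting F → length F ≡ m →
      ∃ λ g → ⟨ σ ⟩ g × ∃ λ x → HasSize (Stab ⟨ σ ⟩ x) m × Enumerates (Coset ⟨ σ ⟩ g x) F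
    maximum-intersecting-is-coset m max F (F-distinct , F⊆G) F-intersecting |F|≡m
      with largest-stabilizer-size max
    ... | refl =
      let g , g∈G , F≡gGy =
            is-coset-of-stabilizer F-distinct F⊆G (intersecting⇒agreeing F-intersecting) |F|≡m
      in g , g∈G , y , stabilizer-size , F≡gGy

theorem2p4 : ∀ (n : ℕ) (σ : Perm (suc n)) → StrictEKR ⟨ σ ⟩
theorem2p4 n σ = intersecting-bound , maximum-intersecting-is-coset
  where open Powers.Blocks σ (Powers.shortestOrbit σ)
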